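{- Let $R$ be a rectilinear region containing an $8\times 8$ square block $S$ of cells. Fix a domino tatami covering of $R$. Suppose some domino of this covering crosses the boundary of $S$, meaning it covers one cell of $S$ and one cell outside $S$. Then at least one of the four corner cells of $S$ is covered by a domino that crosses the boundary of $S$.
   Context: A rectilinear region is a finite union of unit cells of the integer lattice $\mathbb{Z}^2$ (a polyomino, possibly with holes). A domino is a pair of edge-adjacent cells. A domino covering of $R$ is a partition of the cells of $R$ into dominoes. The covering is tatami if no four dominoes meet at a point; equivalently, no $2\times 2$ block of cells of $R$ has its four cells in four distinct dominoes. -}

module Defs where

open import Data.Nat using (ℕ)
open import Data.Integer using (ℤ; _+_; _-_; _≤_; ∣_∣; +_)
open import Data.Product using (_×_; _,_; Σ; ∃; proj₁; proj₂)
open import Data.Sum using (_⊎_)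
open import Data.Fin using (Fin)
open import Data.List using (List)
open import Data.List.Membership.Propositional using (_∈_)
open import Relation.Nullary using (¬_)
open import Relation.Binary.PropositionalEquality using (_≡_; _≢_)

-- A cell of the lattice Z^2, named by its lower-left corner (x , y).
Cell : Set
Cell = ℤ × ℤ

Adjacent : Cell → Cell → Set
Adjacent (x₁ , y₁) (x₂ , y₂) = ∣ x₁ - x₂ ∣ Data.Nat.+ ∣ y₁ - y₂ ∣ ≡ 1

-- A rectilinear region: a finite set of cells, given by a list enumerating it.
Region : Set
Region = List Cell

record Domino : Set where
  constructor domino
  field
    cell₁ : Cell
    cell₂ : Cell
    adj   : Adjacent cell₁ cell₂
open Domino public

_∈D_ : Cell → Domino → Set
c ∈D d = (c ≡ cell₁ d) ⊎ (c ≡ cell₂ d)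

record IsCovering (R : Region) {m : ℕ} (D : Fin m → Domino) : Set where
  field
    inside : ∀ i → (cell₁ (D i) ∈ R) × (cell₂ (D i) ∈ R)
    cover  : ∀ c → c ∈ R → Σ (Fin m) λ i → c ∈D D i
    unique : ∀ c → c ∈ R → ∀ i j → c ∈D D i → c ∈D D j → i ≡ j

block : Cell → Cell × Cell × Cell × Cell
block (x , y) = (x , y) , (x + + 1 , y) , (x , y + + 1) , (x + + 1 , y + + 1)

IsTatami : (R : Region) {m : ℕ} (D : Fin m → Domino) → Set
IsTatami R {m} D =
  ∀ (p : Cell) →
  let (a , b , c , d) = block p in
  a ∈ R → b ∈ R → c ∈ R → d ∈ R →
  ¬ (Σ (Fin m) λ i → Σ (Fin m) λ j → Σ (Fin m) λ k → Σ (Fin m) λ l →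
       (a ∈D D i) × (b ∈D D j) × (c ∈D D k) × (d ∈D D l) ×
       (i ≢ j) × (i ≢ k) × (i ≢ l) × (j ≢ k) × (j ≢ l) × (k ≢ l))

InSquare : Cell → Cell → Set
InSquare (x , y) (u , v) = (x ≤ u) × (u ≤ x + + 7) × (y ≤ v) × (v ≤ y + + 7)

SquareIn : Cell → Region → Set
SquareIn s R = ∀ c → InSquare s c → c ∈ R

Crosses : Cell → Domino → Set
Crosses s d = (InSquare s (cell₁ d) × ¬ InSquare s (cell₂ d))
            ⊎ (InSquare s (cell₂ d) × ¬ InSquare s (cell₁ d))

IsCorner : Cell → Cell → Set
IsCorner (x , y) c =
  (c ≡ (x , y)) ⊎ (c ≡ (x + + 7 , y)) ⊎ (c ≡ (x , y + + 7)) ⊎ (c ≡ (x + + 7 , y + + 7))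

module Submission where

-- Label every cell of the square by the direction of the other cell of its domino, or by `out`
-- when that cell lies outside the square. Matching partners, the tatami condition on every 2×2
-- block and the corner hypothesis are local constraints between neighbouring labels, so the
-- labellings of the square are the runs of an automaton that reads it row by row. Running the
-- automaton over all eight rows shows: if no corner is labelled `out`, then no cell is. Hence if
-- some domino crosses the boundary, some corner domino does.

open import Data.Bool using (Bool; true; false; _∨_)
import Data.Bool.Properties as Bool
open import Data.Empty using (⊥; ⊥-elim)
open import Data.Fin as Fin using (Fin)
import Data.Fin.Properties as Fin
open import Data.Integer as ℤ using (+_; _⊖_; ∣_∣; +≤+)
import Data.Integer.Properties as ℤ
open import Algebra.Properties.AbelianGroup ℤ.+-0-abelianGroup using (∙-cancelˡ)
open import Data.Integer.Tactic.RingSolver using (solve-∀)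
open import Data.List using (List; []; _∷_; [_]; map; concatMap; filter; head)
open import Data.List.Membership.Propositional using (_∈_; find)
open import Data.List.Membership.Propositional.Properties using (∈-map⁺; ∈-concatMap⁺; ∈-filter⁺)
open import Data.List.Relation.Unary.All as All using (All; all?)
open import Data.List.Relation.Unary.All.Properties using (¬All⇒Any¬)
import Data.List.Relation.Unary.Any as Any
open import Data.List.Relation.Unary.Any using (here; there)
open import Data.Maybe using (Maybe; just; nothing)
import Data.Maybe.Properties as Maybe
open import Data.Nat using (ℕ; zero; suc; _+_; _<_; _≤_; _<?_; z≤n; s≤s)
import Data.Nat.Properties as ℕ
open import Data.Product using (Σ; _×_; _,_; proj₁; proj₂; map₂)
import Data.Product.Properties as Product
open import Data.Sum as Sum using (_⊎_; inj₁; inj₂)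
open import Data.Unit using (⊤; tt)
open import Function using (case_of_)
open import Relation.Binary.Definitions using (DecidableEquality)
open import Relation.Binary.PropositionalEquality
  using (_≡_; _≢_; refl; sym; trans; cong; cong₂; subst; subst₂; module ≡-Reasoning)
open import Relation.Nullary using (¬_; Dec; does; yes; no; contradiction)
open import Relation.Nullary.Decidable using (map′; _×-dec_; _⊎-dec_; _→-dec_; ¬?; dec-true; toWitness)

open import Defs

data Dir : Set where
  left right up down out : Dir

_≟_ : DecidableEquality Dir
d ≟ e = map′ code-injective (cong code) (code d ℕ.≟ code e)
  where
  code : Dir → ℕ
  code left  = 0
  code right = 1
  code up    = 2
  code down  = 3
  code out   = 4

  decode : ℕ → Dir
  decode 0 = left
  decode 1 = right
  decode 2 = up
  decode 3 = down
  decode _ = out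

  decode-code : ∀ d → decode (code d) ≡ d
  decode-code left  = refl
  decode-code right = refl
  decode-code up    = refl
  decode-code down  = refl
  decode-code out   = refl

  code-injective : ∀ {d e} → code d ≡ code e → d ≡ e
  code-injective {d} {e} eq = trans (sym (decode-code d)) (trans (cong decode eq) (decode-code e))

directions : List Dir
directions = left ∷ right ∷ up ∷ down ∷ out ∷ []

∈-directions : ∀ d → d ∈ directions
∈-directions left  = here refl
∈-directions right = there (here refl)
∈-directions up    = there (there (here refl))
∈-directions down  = there (there (there (here refl)))
∈-directions out   = there (there (there (there (here refl))))

opposite : Dir → Dir
opposite left  = right
opposite right = left
opposite up    = down
opposite down  = up
opposite out   = out

Point : Set
Point = ℕ × ℕ

InGrid : Point → Set
InGrid (i , j) = i < 8 × j < 8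

InGrid? : ∀ p → Dec (InGrid p)
InGrid? (i , j) = (i <? 8) ×-dec (j <? 8)

corners : List Point
corners = (0 , 0) ∷ (7 , 0) ∷ (0 , 7) ∷ (7 , 7) ∷ []

∈corners⇒InGrid : ∀ {p} → p ∈ corners → InGrid p
∈corners⇒InGrid (here refl)                         = s≤s z≤n , s≤s z≤n
∈corners⇒InGrid (there (here refl))                 = ℕ.≤-refl , s≤s z≤n
∈corners⇒InGrid (there (there (here refl)))         = s≤s z≤n , ℕ.≤-refl
∈corners⇒InGrid (there (there (there (here refl)))) = ℕ.≤-refl , ℕ.≤-refl

_∈corners? : ∀ p → Dec (p ∈ corners)
p ∈corners? = Any.any? (Product.≡-dec ℕ._≟_ ℕ._≟_ p) corners

data Step : Dir → Point → Point → Set where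
  goRight : ∀ {i j} → Step right (i , j) (suc i , j)
  goLeft  : ∀ {i j} → Step left (suc i , j) (i , j)
  goUp    : ∀ {i j} → Step up (i , j) (i , suc j)
  goDown  : ∀ {i j} → Step down (i , suc j) (i , j)

step-irreflexive : ∀ {d p} → ¬ Step d p p
step-irreflexive ()

step-direction : ∀ {d e p q} → Step d p q → Step e p q → d ≡ e
step-direction goRight goRight = refl
step-direction goLeft  goLeft  = refl
step-direction goUp    goUp    = refl
step-direction goDown  goDown  = refl

step-reverse : ∀ {d p q} → Step d p q → Step (opposite d) q p
step-reverse goRight = goLeft
step-reverse goLeft  = goRight
step-reverse goUp    = goDown
step-reverse goDown  = goUp

-- Labellings and the row-by-row automaton

DominoInBlock : (Point → Dir) → ℕ → ℕ → Set
DominoInBlock label i j =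
  label (i , j) ≡ right ⊎ label (i , j) ≡ up ⊎ label (suc i , j) ≡ up ⊎ label (i , suc j) ≡ right

record IsTatamiLabelling (label : Point → Dir) : Set where
  field
    paired : ∀ {p d} → InGrid p → label p ≡ d → d ≢ out →
             Σ Point λ q → Step d p q × InGrid q × label q ≡ opposite d
    tatami : ∀ {i j} → suc i < 8 → suc j < 8 → DominoInBlock label i j

Row : Set
Row = List Dir

-- The label d of cell (x , y) against the labels onLeft of (x - 1 , y), below of (x , y - 1)
-- and belowRight of (x + 1 , y - 1) (nothing in the last column). The last conjunct is the
-- tatami condition for the block with bottom-left cell (x , y - 1).
CellFits : (y x : ℕ) (onLeft below : Dir) (belowRight : Maybe Dir) (d : Dir) → Set
CellFits y x onLeft below belowRight d =
  (onLeft ≡ right → d ≡ left) × (d ≡ left → onLeft ≡ right) ×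
  (below ≡ up → d ≡ down) × (d ≡ down → below ≡ up) ×
  (d ≡ right → suc x < 8) × (d ≡ up → suc y < 8) × ((x , y) ∈ corners → d ≢ out) ×
  (suc x < 8 → below ≡ right ⊎ below ≡ up ⊎ belowRight ≡ just up ⊎ d ≡ right)

cellFits? : ∀ y x onLeft below belowRight d → Dec (CellFits y x onLeft below belowRight d)
cellFits? y x onLeft below belowRight d =
  ((onLeft ≟ right) →-dec (d ≟ left)) ×-dec ((d ≟ left) →-dec (onLeft ≟ right)) ×-dec
  ((below ≟ up) →-dec (d ≟ down)) ×-dec ((d ≟ down) →-dec (below ≟ up)) ×-dec
  ((d ≟ right) →-dec (suc x <? 8)) ×-dec ((d ≟ up) →-dec (suc y <? 8)) ×-dec
  (((x , y) ∈corners?) →-dec ¬? (d ≟ out)) ×-dec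
  ((suc x <? 8) →-dec ((below ≟ right) ⊎-dec (below ≟ up) ⊎-dec
                       (Maybe.≡-dec _≟_ belowRight (just up)) ⊎-dec (d ≟ right)))

Fits : (y x : ℕ) → Dir → Row → Row → Set
Fits y x onLeft []       []       = ⊤
Fits y x onLeft (b ∷ bs) (d ∷ ds) = CellFits y x onLeft b (head bs) d × Fits y (suc x) d bs ds
Fits _ _ _      _        _        = ⊥

fittingRows : (y x : ℕ) → Dir → Row → List Row
fittingRows y x onLeft []       = [ [] ]
fittingRows y x onLeft (b ∷ bs) =
  concatMap (λ d → map (d ∷_) (fittingRows y (suc x) d bs))
            (filter (cellFits? y x onLeft b (head bs)) directions)

fittingRows-complete : ∀ y x onLeft below row → Fits y x onLeft below row →
                       row ∈ fittingRows y x onLeft below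
fittingRows-complete y x onLeft []       []       _            = here refl
fittingRows-complete y x onLeft (b ∷ bs) (d ∷ ds) (fits , rest) =
  ∈-concatMap⁺ _ (Any.map (λ { refl → ∈-map⁺ (d ∷_) (fittingRows-complete y (suc x) d bs ds rest) })
                          (∈-filter⁺ (cellFits? y x onLeft b (head bs)) (∈-directions d) fits))

hasOut : Row → Bool
hasOut r = does (Any.any? (out ≟_) r)

-- A state is the last row read, together with whether `out` has occurred in any row so far.
successors : ℕ → Row × Bool → List (Row × Bool)
successors y (below , seen) = map (λ r → r , (seen ∨ hasOut r)) (fittingRows y 0 out below)

segment : (ℕ → Dir) → ℕ → ℕ → Row
segment f x zero    = []
segment f x (suc n) = f x ∷ segment f (suc x) n

∈-segment : ∀ f {n} x i → i < n → f (x + i) ∈ segment f x n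
∈-segment f {suc n} x zero    _         = here (cong f (ℕ.+-identityʳ x))
∈-segment f {suc n} x (suc i) (s≤s i<n) =
  there (subst (λ k → f k ∈ segment f (suc x) n) (sym (ℕ.+-suc x i)) (∈-segment f (suc x) i i<n))

-- A virtual row of horizontal dominoes under the square: it rules out `down` in row 0 and
-- satisfies the tatami condition vacuously.
floor : Row
floor = segment (λ _ → right) 0 8

reachable : ℕ → List (Row × Bool)
reachable zero    = successors 0 (floor , false)
reachable (suc y) = concatMap (successors (suc y)) (reachable y)

out-unreachable : All (λ state → proj₂ state ≡ false) (reachable 7)
out-unreachable = toWitness {a? = all? (λ state → proj₂ state Bool.≟ false) (reachable 7)} _

module _ {label : Point → Dir} (L : IsTatamiLabelling label)
         (corners-paired : ∀ {p} → p ∈ corners → label p ≢ out) where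
  open IsTatamiLabelling L

  rowOf : ℕ → Row
  rowOf y = segment (λ x → label (x , y)) 0 8

  leftNeighbour : ℕ → ℕ → Dir
  leftNeighbour y zero    = out
  leftNeighbour y (suc x) = label (x , y)

  record Supports (y : ℕ) (below : ℕ → Dir) : Set where
    field
      up⇒down : ∀ {x} → x < 8 → below x ≡ up → label (x , y) ≡ down
      down⇒up : ∀ {x} → x < 8 → label (x , y) ≡ down → below x ≡ up
      blocks  : ∀ {x} → suc x < 8 →
                below x ≡ right ⊎ below x ≡ up ⊎ below (suc x) ≡ up ⊎ label (x , y) ≡ right

  floor-supports : Supports 0 (λ _ → right)
  floor-supports = record
    { up⇒down = λ _ ()
    ; down⇒up = λ x<8 eq → case paired (x<8 , s≤s z≤n) eq (λ ()) of λ { (_ , () , _) }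
    ; blocks  = λ _ → inj₁ refl
    }

  row-supports : ∀ {y} → suc y < 8 → Supports (suc y) (λ x → label (x , y))
  row-supports {y} sy<8 = record
    { up⇒down = λ x<8 eq → case paired (x<8 , ℕ.<⇒≤ sy<8) eq (λ ()) of λ { (_ , goUp , _ , eq′) → eq′ }
    ; down⇒up = λ x<8 eq → case paired (x<8 , sy<8) eq (λ ()) of λ { (_ , goDown , _ , eq′) → eq′ }
    ; blocks  = λ sx<8 → tatami sx<8 sy<8
    }

  leftNeighbour-right : ∀ {x y} → InGrid (x , y) → leftNeighbour y x ≡ right → label (x , y) ≡ left
  leftNeighbour-right {suc x} (sx<8 , y<8) eq with paired (ℕ.<⇒≤ sx<8 , y<8) eq (λ ())
  ... | _ , goRight , _ , eq′ = eq′

  left⇒leftNeighbour-right : ∀ {x y} → InGrid (x , y) → label (x , y) ≡ left → leftNeighbour y x ≡ right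
  left⇒leftNeighbour-right g eq with paired g eq (λ ())
  ... | _ , goLeft , _ , eq′ = eq′

  right⇒suc<8 : ∀ {x y} → InGrid (x , y) → label (x , y) ≡ right → suc x < 8
  right⇒suc<8 g eq with paired g eq (λ ())
  ... | _ , goRight , (sx<8 , _) , _ = sx<8

  up⇒suc<8 : ∀ {x y} → InGrid (x , y) → label (x , y) ≡ up → suc y < 8
  up⇒suc<8 g eq with paired g eq (λ ())
  ... | _ , goUp , (_ , sy<8) , _ = sy<8

  cell-fits : ∀ {x y below belowRight} → InGrid (x , y) → Supports y below →
              (suc x < 8 → belowRight ≡ just (below (suc x))) →
              CellFits y x (leftNeighbour y x) (below x) belowRight (label (x , y))
  cell-fits {x} {y} {below} {belowRight} g@(x<8 , _) S belowRight≡ =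
    leftNeighbour-right g , left⇒leftNeighbour-right g , up⇒down x<8 , down⇒up x<8 ,
    right⇒suc<8 g , up⇒suc<8 g , corners-paired , tatami′
    where
    open Supports S
    tatami′ : suc x < 8 → below x ≡ right ⊎ below x ≡ up ⊎ belowRight ≡ just up ⊎ label (x , y) ≡ right
    tatami′ sx<8 with blocks sx<8
    ... | inj₁ eq               = inj₁ eq
    ... | inj₂ (inj₁ eq)        = inj₂ (inj₁ eq)
    ... | inj₂ (inj₂ (inj₁ eq)) = inj₂ (inj₂ (inj₁ (trans (belowRight≡ sx<8) (cong just eq))))
    ... | inj₂ (inj₂ (inj₂ eq)) = inj₂ (inj₂ (inj₂ eq))

  segment-fits : ∀ {y below} → y < 8 → Supports y below → ∀ n x → x + n ≡ 8 →
                 Fits y x (leftNeighbour y x) (segment below x n) (segment (λ x → label (x , y)) x n)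
  segment-fits y<8 S zero    x _  = tt
  segment-fits y<8 S (suc n) x eq =
    cell-fits (x<8 , y<8) S (head-segment n eq) ,
    segment-fits y<8 S n (suc x) (trans (sym (ℕ.+-suc x n)) eq)
    where
    x<8 : x < 8
    x<8 = subst (x <_) eq (ℕ.m<m+n x (s≤s z≤n))
    head-segment : ∀ {f} n → x + suc n ≡ 8 → suc x < 8 → head (segment f (suc x) n) ≡ just (f (suc x))
    head-segment zero    eq sx<8 = ⊥-elim (ℕ.<-irrefl (trans (ℕ.+-comm 1 x) eq) sx<8)
    head-segment (suc n) _  _    = refl

  seenOut : ℕ → Bool
  seenOut zero    = hasOut (rowOf 0)
  seenOut (suc y) = seenOut y ∨ hasOut (rowOf (suc y))

  rows-reachable : ∀ {y} → y < 8 → (rowOf y , seenOut y) ∈ reachable y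
  rows-reachable {zero} y<8 =
    ∈-map⁺ (λ r → r , (false ∨ hasOut r))
      (fittingRows-complete 0 0 out floor (rowOf 0) (segment-fits y<8 floor-supports 8 0 refl))
  rows-reachable {suc y} sy<8 =
    ∈-concatMap⁺ (successors (suc y))
      (Any.map (λ { refl → ∈-map⁺ (λ r → r , (seenOut y ∨ hasOut r))
                             (fittingRows-complete (suc y) 0 out (rowOf y) (rowOf (suc y))
                               (segment-fits sy<8 (row-supports sy<8) 8 0 refl)) })
               (rows-reachable (ℕ.<⇒≤ sy<8)))

  hasOut⇒seenOut : ∀ {j y} → j ≤ y → hasOut (rowOf j) ≡ true → seenOut y ≡ true
  hasOut⇒seenOut {y = zero} z≤n has = has
  hasOut⇒seenOut {j} {suc y} j≤sy has with ℕ.m≤n⇒m<n∨m≡n j≤sy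
  ... | inj₁ (s≤s j≤y) = cong (_∨ hasOut (rowOf (suc y))) (hasOut⇒seenOut j≤y has)
  ... | inj₂ refl      = trans (cong (seenOut y ∨_) has) (Bool.∨-zeroʳ (seenOut y))

  no-out : ∀ {p} → InGrid p → label p ≢ out
  no-out {i , j} (i<8 , s≤s j≤7) eq = contradiction (begin
    false      ≡⟨ All.lookup out-unreachable (rows-reachable {7} ℕ.≤-refl) ⟨
    seenOut 7  ≡⟨ hasOut⇒seenOut j≤7 (dec-true (Any.any? (out ≟_) (rowOf j)) out∈row) ⟩
    true       ∎) λ ()
    where
    open ≡-Reasoning
    out∈row : out ∈ rowOf j
    out∈row = subst (_∈ rowOf j) eq (∈-segment (λ x → label (x , j)) 0 i i<8)

-- Tilings of the grid

Distinct₄ : {K : Set} → K → K → K → K → Set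
Distinct₄ a b c d = a ≢ b × a ≢ c × a ≢ d × b ≢ c × b ≢ d × c ≢ d

-- dom p names the domino covering the grid cell p; dominoes may stick out of the grid.
module Tiling {K : Set} (_≟ᵏ_ : DecidableEquality K) (dom : Point → K) where

  Mate : Point → Point → Set
  Mate p q = InGrid q × dom q ≡ dom p

  MateIn : Dir → Point → Set
  MateIn d p = Σ Point λ q → Step d p q × Mate p q

  HasMate : Point → Set
  HasMate p = Σ Dir λ d → MateIn d p

  record IsTatamiTiling : Set where
    field
      at-most-two    : ∀ {p q r} → InGrid p → Mate p q → Mate p r → p ≡ q ⊎ p ≡ r ⊎ q ≡ r
      mates-adjacent : ∀ {p q} → InGrid p → Mate p q → p ≢ q → Σ Dir λ d → Step d p q
      tatami         : ∀ {i j} → suc i < 8 → suc j < 8 →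
                       ¬ Distinct₄ (dom (i , j)) (dom (suc i , j)) (dom (i , suc j)) (dom (suc i , suc j))

  mate? : ∀ p q → Dec (Mate p q)
  mate? p q = InGrid? q ×-dec (dom q ≟ᵏ dom p)

  mateIn? : ∀ d p → Dec (MateIn d p)
  mateIn? right (i , j)     = map′ (λ m → _ , goRight , m) (λ { (_ , goRight , m) → m }) (mate? (i , j) (suc i , j))
  mateIn? left  (suc i , j) = map′ (λ m → _ , goLeft  , m) (λ { (_ , goLeft  , m) → m }) (mate? (suc i , j) (i , j))
  mateIn? up    (i , j)     = map′ (λ m → _ , goUp    , m) (λ { (_ , goUp    , m) → m }) (mate? (i , j) (i , suc j))
  mateIn? down  (i , suc j) = map′ (λ m → _ , goDown  , m) (λ { (_ , goDown  , m) → m }) (mate? (i , suc j) (i , j))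
  mateIn? left  (zero , j)  = no λ { (_ , () , _) }
  mateIn? down  (i , zero)  = no λ { (_ , () , _) }
  mateIn? out   p           = no λ { (_ , () , _) }

  hasMate? : ∀ p → Dec (HasMate p)
  hasMate? p = map′ Any.satisfied (λ (d , m) → Any.map (λ { refl → m }) (∈-directions d))
                    (Any.any? (λ d → mateIn? d p) directions)

  firstMate : List Dir → Point → Dir
  firstMate []       p = out
  firstMate (d ∷ ds) p with mateIn? d p
  ... | yes _ = d
  ... | no  _ = firstMate ds p

  label : Point → Dir
  label = firstMate directions

  module _ (T : IsTatamiTiling) where
    open IsTatamiTiling T

    mate-direction-unique : ∀ {p d e} → InGrid p → MateIn d p → MateIn e p → d ≡ e
    mate-direction-unique g (_ , s , m) (_ , t , n) with at-most-two g m n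
    ... | inj₁ refl        = contradiction s step-irreflexive
    ... | inj₂ (inj₁ refl) = contradiction t step-irreflexive
    ... | inj₂ (inj₂ refl) = step-direction s t

    firstMate-sound : ∀ ds p → firstMate ds p ≢ out → MateIn (firstMate ds p) p
    firstMate-sound []       p ¬out = contradiction refl ¬out
    firstMate-sound (d ∷ ds) p ¬out with mateIn? d p
    ... | yes m = m
    ... | no  _ = firstMate-sound ds p ¬out

    firstMate-complete : ∀ {d p} ds → InGrid p → d ∈ ds → MateIn d p → firstMate ds p ≡ d
    firstMate-complete {p = p} (e ∷ ds) g d∈ m with mateIn? e p
    ... | yes m′ = mate-direction-unique g m′ m
    ... | no ¬m′ with d∈
    ...   | here refl  = contradiction m ¬m′
    ...   | there d∈ds = firstMate-complete ds g d∈ds m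

    label-sound : ∀ {p} → label p ≢ out → MateIn (label p) p
    label-sound = firstMate-sound directions _

    label-complete : ∀ {d p} → InGrid p → MateIn d p → label p ≡ d
    label-complete {d} g = firstMate-complete directions g (∈-directions d)

    label-mated : ∀ {p} → InGrid p → HasMate p → label p ≢ out
    label-mated g (_ , m@(_ , s , _)) eq with trans (sym (label-complete g m)) eq | s
    ... | refl | ()

    labelling : IsTatamiLabelling label
    labelling = record { paired = paired ; tatami = blocks }
      where
      paired : ∀ {p d} → InGrid p → label p ≡ d → d ≢ out →
               Σ Point λ q → Step d p q × InGrid q × label q ≡ opposite d
      paired {p} g refl ¬out with label-sound ¬out
      ... | q , s , gq , eq = q , s , gq , label-complete gq (p , step-reverse s , g , sym eq)

      blocks : ∀ {i j} → suc i < 8 → suc j < 8 → DominoInBlock label i j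
      blocks {i} {j} si<8 sj<8
        with label (i , j) ≟ right | label (i , j) ≟ up | label (suc i , j) ≟ up | label (i , suc j) ≟ right
      ... | yes eq | _      | _      | _      = inj₁ eq
      ... | no _   | yes eq | _      | _      = inj₂ (inj₁ eq)
      ... | no _   | no _   | yes eq | _      = inj₂ (inj₂ (inj₁ eq))
      ... | no _   | no _   | no _   | yes eq = inj₂ (inj₂ (inj₂ eq))
      ... | no ¬r  | no ¬u  | no ¬u′ | no ¬r′ =
        contradiction (ab , ac , ad , bc , bd , cd) (tatami si<8 sj<8)
        where
        i<8 = ℕ.<⇒≤ si<8
        j<8 = ℕ.<⇒≤ sj<8
        ab : dom (i , j) ≢ dom (suc i , j)
        ab eq = ¬r (label-complete (i<8 , j<8) (_ , goRight , (si<8 , j<8) , sym eq))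
        ac : dom (i , j) ≢ dom (i , suc j)
        ac eq = ¬u (label-complete (i<8 , j<8) (_ , goUp , (i<8 , sj<8) , sym eq))
        ad : dom (i , j) ≢ dom (suc i , suc j)
        ad eq with mates-adjacent (i<8 , j<8) ((si<8 , sj<8) , sym eq) (λ ())
        ... | _ , ()
        bc : dom (suc i , j) ≢ dom (i , suc j)
        bc eq with mates-adjacent (si<8 , j<8) ((i<8 , sj<8) , sym eq) (λ ())
        ... | _ , ()
        bd : dom (suc i , j) ≢ dom (suc i , suc j)
        bd eq = ¬u′ (label-complete (si<8 , j<8) (_ , goUp , (si<8 , sj<8) , sym eq))
        cd : dom (i , suc j) ≢ dom (suc i , suc j)
        cd eq = ¬r′ (label-complete (i<8 , sj<8) (_ , goRight , (si<8 , sj<8) , sym eq))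

    mated-everywhere : (∀ {p} → p ∈ corners → HasMate p) → ∀ {p} → InGrid p → HasMate p
    mated-everywhere corners-mated {p} g =
      label p , label-sound (no-out labelling (λ c → label-mated (∈corners⇒InGrid c) (corners-mated c)) g)

-- The square in ℤ²

cellAt : Cell → Point → Cell
cellAt (x , y) (i , j) = (x ℤ.+ + i , y ℤ.+ + j)

cellAt-injective : ∀ s {p q} → cellAt s p ≡ cellAt s q → p ≡ q
cellAt-injective (x , y) eq =
  cong₂ _,_ (ℤ.+-injective (∙-cancelˡ x _ _ (cong proj₁ eq)))
            (ℤ.+-injective (∙-cancelˡ y _ _ (cong proj₂ eq)))

InSquare-cellAt : ∀ s {p} → InGrid p → InSquare s (cellAt s p)
InSquare-cellAt (x , y) {i , j} (i<8 , j<8) =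
  ℤ.i≤i+j x (+ i) , ℤ.+-monoʳ-≤ x (+≤+ (ℕ.≤-pred i<8)) ,
  ℤ.i≤i+j y (+ j) , ℤ.+-monoʳ-≤ y (+≤+ (ℕ.≤-pred j<8))

x+[u-x]≡u : ∀ x u → x ℤ.+ (u ℤ.- x) ≡ u
x+[u-x]≡u = solve-∀

[x+i]-x≡i : ∀ x i → (x ℤ.+ i) ℤ.- x ≡ i
[x+i]-x≡i = solve-∀

[x+i]-[x+a]≡i-a : ∀ x i a → (x ℤ.+ i) ℤ.- (x ℤ.+ a) ≡ i ℤ.- a
[x+i]-[x+a]≡i-a = solve-∀

[x+i]+1≡x+[1+i] : ∀ x i → (x ℤ.+ i) ℤ.+ + 1 ≡ x ℤ.+ (+ 1 ℤ.+ i)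
[x+i]+1≡x+[1+i] = solve-∀

offset : ∀ {x u} → x ℤ.≤ u → u ℤ.≤ x ℤ.+ + 7 → Σ ℕ λ i → i < 8 × u ≡ x ℤ.+ + i
offset {x} {u} x≤u u≤x+7 = ∣ x ℤ.- u ∣ , s≤s (ℤ.drop‿+≤+ i≤7) , (begin
  u                    ≡⟨ x+[u-x]≡u x u ⟨
  x ℤ.+ (u ℤ.- x)      ≡⟨ cong (λ k → x ℤ.+ k) distance ⟨
  x ℤ.+ + ∣ x ℤ.- u ∣  ∎)
  where
  open ≡-Reasoning
  distance : + ∣ x ℤ.- u ∣ ≡ u ℤ.- x
  distance = ℤ.∣-∣-≤ x≤u
  i≤7 : + ∣ x ℤ.- u ∣ ℤ.≤ + 7
  i≤7 = subst₂ ℤ._≤_ (sym distance) ([x+i]-x≡i x (+ 7)) (ℤ.+-monoˡ-≤ (ℤ.- x) u≤x+7)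

InSquare⇒cellAt : ∀ s {c} → InSquare s c → Σ Point λ p → InGrid p × c ≡ cellAt s p
InSquare⇒cellAt (x , y) (x≤u , u≤x+7 , y≤v , v≤y+7)
  with offset x≤u u≤x+7 | offset y≤v v≤y+7
... | i , i<8 , refl | j , j<8 , refl = (i , j) , (i<8 , j<8) , refl

∣m⊖n∣≡0⇒m≡n : ∀ m n → ∣ m ⊖ n ∣ ≡ 0 → m ≡ n
∣m⊖n∣≡0⇒m≡n zero    zero    _  = refl
∣m⊖n∣≡0⇒m≡n (suc m) (suc n) eq =
  cong suc (∣m⊖n∣≡0⇒m≡n m n (trans (cong ∣_∣ (sym (ℤ.[1+m]⊖[1+n]≡m⊖n m n))) eq))

∣m⊖n∣≡1⇒n≡1+m⊎m≡1+n : ∀ m n → ∣ m ⊖ n ∣ ≡ 1 → n ≡ suc m ⊎ m ≡ suc n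
∣m⊖n∣≡1⇒n≡1+m⊎m≡1+n zero       (suc zero) _  = inj₁ refl
∣m⊖n∣≡1⇒n≡1+m⊎m≡1+n (suc zero) zero       _  = inj₂ refl
∣m⊖n∣≡1⇒n≡1+m⊎m≡1+n (suc m)    (suc n)    eq = Sum.map (cong suc) (cong suc)
  (∣m⊖n∣≡1⇒n≡1+m⊎m≡1+n m n (trans (cong ∣_∣ (sym (ℤ.[1+m]⊖[1+n]≡m⊖n m n))) eq))

m+n≡1⇒ : ∀ {m n} → m + n ≡ 1 → (m ≡ 0 × n ≡ 1) ⊎ (m ≡ 1 × n ≡ 0)
m+n≡1⇒ {zero}           eq = inj₁ (refl , eq)
m+n≡1⇒ {suc zero} {zero} _ = inj₂ (refl , refl)

unit-distance⇒step : ∀ {i j a b} → ∣ i ⊖ a ∣ + ∣ j ⊖ b ∣ ≡ 1 → Σ Dir λ d → Step d (i , j) (a , b)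
unit-distance⇒step {i} {j} {a} {b} eq with m+n≡1⇒ eq
... | inj₁ (h , v) with ∣m⊖n∣≡0⇒m≡n i a h | ∣m⊖n∣≡1⇒n≡1+m⊎m≡1+n j b v
...   | refl | inj₁ refl = up , goUp
...   | refl | inj₂ refl = down , goDown
unit-distance⇒step {i} {j} {a} {b} eq | inj₂ (h , v)
  with ∣m⊖n∣≡1⇒n≡1+m⊎m≡1+n i a h | ∣m⊖n∣≡0⇒m≡n j b v
...   | inj₁ refl | refl = right , goRight
...   | inj₂ refl | refl = left , goLeft

offset-difference : ∀ x i a → (x ℤ.+ + i) ℤ.- (x ℤ.+ + a) ≡ i ⊖ a
offset-difference x i a = trans ([x+i]-[x+a]≡i-a x (+ i) (+ a)) (ℤ.[+m]-[+n]≡m⊖n i a)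

adjacent⇒step : ∀ s {p q} → Adjacent (cellAt s p) (cellAt s q) → Σ Dir λ d → Step d p q
adjacent⇒step (x , y) {i , j} {a , b} adj =
  unit-distance⇒step
    (subst₂ (λ u v → ∣ u ∣ + ∣ v ∣ ≡ 1) (offset-difference x i a) (offset-difference y j b) adj)

block-cellAt : ∀ s i j → block (cellAt s (i , j)) ≡
  (cellAt s (i , j) , cellAt s (suc i , j) , cellAt s (i , suc j) , cellAt s (suc i , suc j))
block-cellAt (x , y) i j rewrite [x+i]+1≡x+[1+i] x (+ i) | [x+i]+1≡x+[1+i] y (+ j) = refl

∈corners⇒IsCorner : ∀ s {p} → p ∈ corners → IsCorner s (cellAt s p)
∈corners⇒IsCorner (x , y) (here refl) =
  inj₁ (cong₂ _,_ (ℤ.+-identityʳ x) (ℤ.+-identityʳ y))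
∈corners⇒IsCorner (x , y) (there (here refl)) =
  inj₂ (inj₁ (cong (_ ,_) (ℤ.+-identityʳ y)))
∈corners⇒IsCorner (x , y) (there (there (here refl))) =
  inj₂ (inj₂ (inj₁ (cong (_, _) (ℤ.+-identityʳ x))))
∈corners⇒IsCorner (x , y) (there (there (there (here refl)))) =
  inj₂ (inj₂ (inj₂ refl))

adjacent-sym : ∀ {a b} → Adjacent a b → Adjacent b a
adjacent-sym {x₁ , y₁} {x₂ , y₂} adj rewrite ℤ.∣i-j∣≡∣j-i∣ x₂ x₁ | ℤ.∣i-j∣≡∣j-i∣ y₂ y₁ = adj

adjacent-irreflexive : ∀ {a} → ¬ Adjacent a a
adjacent-irreflexive {x , y} adj rewrite ℤ.+-inverseʳ x | ℤ.+-inverseʳ y with adj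
... | ()

cells-distinct : ∀ d → cell₁ d ≢ cell₂ d
cells-distinct d eq = adjacent-irreflexive {cell₁ d} (subst (Adjacent (cell₁ d)) (sym eq) (adj d))

∈D-at-most-two : ∀ d {a b c} → a ∈D d → b ∈D d → c ∈D d → a ≡ b ⊎ a ≡ c ⊎ b ≡ c
∈D-at-most-two _ (inj₁ refl) (inj₁ refl) _           = inj₁ refl
∈D-at-most-two _ (inj₂ refl) (inj₂ refl) _           = inj₁ refl
∈D-at-most-two _ (inj₁ refl) (inj₂ refl) (inj₁ refl) = inj₂ (inj₁ refl)
∈D-at-most-two _ (inj₁ refl) (inj₂ refl) (inj₂ refl) = inj₂ (inj₂ refl)
∈D-at-most-two _ (inj₂ refl) (inj₁ refl) (inj₁ refl) = inj₂ (inj₂ refl)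
∈D-at-most-two _ (inj₂ refl) (inj₁ refl) (inj₂ refl) = inj₂ (inj₁ refl)

∈D-adjacent : ∀ d {a b} → a ∈D d → b ∈D d → a ≢ b → Adjacent a b
∈D-adjacent d (inj₁ refl) (inj₂ refl) _   = adj d
∈D-adjacent d (inj₂ refl) (inj₁ refl) _   = adjacent-sym {cell₁ d} {cell₂ d} (adj d)
∈D-adjacent _ (inj₁ refl) (inj₁ refl) a≢b = contradiction refl a≢b
∈D-adjacent _ (inj₂ refl) (inj₂ refl) a≢b = contradiction refl a≢b

partner : ∀ d {c} → c ∈D d → Σ Cell λ e → e ∈D d × e ≢ c
partner d (inj₁ refl) = cell₂ d , inj₂ refl , λ eq → cells-distinct d (sym eq)
partner d (inj₂ refl) = cell₁ d , inj₁ refl , cells-distinct d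

crossing : ∀ {s} d {c e} → c ∈D d → e ∈D d → e ≢ c → InSquare s c → ¬ InSquare s e → Crosses s d
crossing _ (inj₁ refl) (inj₂ refl) _   c∈S e∉S = inj₁ (c∈S , e∉S)
crossing _ (inj₂ refl) (inj₁ refl) _   c∈S e∉S = inj₂ (c∈S , e∉S)
crossing _ (inj₁ refl) (inj₁ refl) e≢c _   _   = contradiction refl e≢c
crossing _ (inj₂ refl) (inj₂ refl) e≢c _   _   = contradiction refl e≢c

-- A tatami covering seen from the square

module Covering (R : Region) (s : Cell) (square : SquareIn s R)
                {m : ℕ} (D : Fin m → Domino) (covering : IsCovering R D) (tatami : IsTatami R D) where
  open IsCovering covering

  cellAt∈R : ∀ {p} → InGrid p → cellAt s p ∈ R
  cellAt∈R g = square _ (InSquare-cellAt s g)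

  dominoAt : ∀ {p} → InGrid p → Fin m
  dominoAt g = proj₁ (cover _ (cellAt∈R g))

  ∈dominoAt : ∀ {p} (g : InGrid p) → cellAt s p ∈D D (dominoAt g)
  ∈dominoAt g = proj₂ (cover _ (cellAt∈R g))

  dom : Point → Maybe (Fin m)
  dom p with InGrid? p
  ... | yes g = just (dominoAt g)
  ... | no  _ = nothing

  dom-unique : ∀ {p k} → InGrid p → cellAt s p ∈D D k → dom p ≡ just k
  dom-unique {p} g mem with InGrid? p
  ... | yes g′ = cong just (unique _ (cellAt∈R g′) _ _ (∈dominoAt g′) mem)
  ... | no ¬g  = contradiction g ¬g

  dominoAt-distinct : ∀ {p q} (gp : InGrid p) (gq : InGrid q) → dom p ≢ dom q → dominoAt gp ≢ dominoAt gq
  dominoAt-distinct gp gq ne eq =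
    ne (trans (dom-unique gp (∈dominoAt gp)) (trans (cong just eq) (sym (dom-unique gq (∈dominoAt gq)))))

  open Tiling (Maybe.≡-dec Fin._≟_) dom public

  mate-∈D : ∀ {p q} k → InGrid p → Mate p q → cellAt s p ∈D D k → cellAt s q ∈D D k
  mate-∈D {q = q} k g (gq , eq) mem =
    subst (λ k → cellAt s q ∈D D k)
          (Maybe.just-injective (trans (sym (dom-unique gq (∈dominoAt gq))) (trans eq (dom-unique g mem))))
          (∈dominoAt gq)

  BlockTatami : Cell × Cell × Cell × Cell → Set
  BlockTatami (a , b , c , d) =
    a ∈ R → b ∈ R → c ∈ R → d ∈ R →
    ¬ (Σ (Fin m) λ i → Σ (Fin m) λ j → Σ (Fin m) λ k → Σ (Fin m) λ l →
         (a ∈D D i) × (b ∈D D j) × (c ∈D D k) × (d ∈D D l) ×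
         (i ≢ j) × (i ≢ k) × (i ≢ l) × (j ≢ k) × (j ≢ l) × (k ≢ l))

  tiling : IsTatamiTiling
  tiling = record { at-most-two = at-most-two ; mates-adjacent = mates-adjacent ; tatami = blocks }
    where
    at-most-two : ∀ {p q r} → InGrid p → Mate p q → Mate p r → p ≡ q ⊎ p ≡ r ⊎ q ≡ r
    at-most-two g mq mr =
      Sum.map (cellAt-injective s) (Sum.map (cellAt-injective s) (cellAt-injective s))
        (∈D-at-most-two (D k) mp (mate-∈D k g mq mp) (mate-∈D k g mr mp))
      where
      k  = dominoAt g
      mp = ∈dominoAt g

    mates-adjacent : ∀ {p q} → InGrid p → Mate p q → p ≢ q → Σ Dir λ d → Step d p q
    mates-adjacent g mq p≢q =
      adjacent⇒step s (∈D-adjacent (D k) (∈dominoAt g) (mate-∈D k g mq (∈dominoAt g))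
                                   (λ eq → p≢q (cellAt-injective s eq)))
      where k = dominoAt g

    blocks : ∀ {i j} → suc i < 8 → suc j < 8 →
             ¬ Distinct₄ (dom (i , j)) (dom (suc i , j)) (dom (i , suc j)) (dom (suc i , suc j))
    blocks {i} {j} si<8 sj<8 (ab , ac , ad , bc , bd , cd) =
      subst BlockTatami (block-cellAt s i j) (tatami (cellAt s (i , j)))
        (cellAt∈R ga) (cellAt∈R gb) (cellAt∈R gc) (cellAt∈R gd)
        ( dominoAt ga , dominoAt gb , dominoAt gc , dominoAt gd
        , ∈dominoAt ga , ∈dominoAt gb , ∈dominoAt gc , ∈dominoAt gd
        , dominoAt-distinct ga gb ab , dominoAt-distinct ga gc ac , dominoAt-distinct ga gd ad
        , dominoAt-distinct gb gc bc , dominoAt-distinct gb gd bd , dominoAt-distinct gc gd cd )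
      where
      ga = ℕ.<⇒≤ si<8 , ℕ.<⇒≤ sj<8
      gb = si<8 , ℕ.<⇒≤ sj<8
      gc = ℕ.<⇒≤ si<8 , sj<8
      gd = si<8 , sj<8

  open IsTatamiTiling tiling using (mates-adjacent)

  stays-inside : (∀ {p} → InGrid p → HasMate p) → ∀ {c e k} →
                 c ∈D D k → e ∈D D k → InSquare s c → ¬ ¬ InSquare s e
  stays-inside mated {k = k} mc me c∈S e∉S with InSquare⇒cellAt s c∈S
  ... | p , g , refl with mated g
  ... | d , q , step , mate@(gq , _) with ∈D-at-most-two (D k) mc (mate-∈D k g mate mc) me
  ... | inj₁ eq          = step-irreflexive (subst (Step d p) (sym (cellAt-injective s eq)) step)
  ... | inj₂ (inj₁ refl) = e∉S c∈S
  ... | inj₂ (inj₂ eq)   = e∉S (subst (InSquare s) eq (InSquare-cellAt s gq))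

  no-crossing : (∀ {p} → InGrid p → HasMate p) → ∀ {k} → ¬ Crosses s (D k)
  no-crossing mated {k} (inj₁ (c∈S , e∉S)) = stays-inside mated {k = k} (inj₁ refl) (inj₂ refl) c∈S e∉S
  no-crossing mated {k} (inj₂ (c∈S , e∉S)) = stays-inside mated {k = k} (inj₂ refl) (inj₁ refl) c∈S e∉S

  unmated-crosses : ∀ {p} (g : InGrid p) → ¬ HasMate p → Crosses s (D (dominoAt g))
  unmated-crosses {p} g unmated with partner (D (dominoAt g)) (∈dominoAt g)
  ... | e , me , e≢c = crossing (D (dominoAt g)) (∈dominoAt g) me e≢c (InSquare-cellAt s g) e∉S
    where
    e∉S : ¬ InSquare s e
    e∉S e∈S with InSquare⇒cellAt s e∈S
    ... | q , gq , refl =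
      unmated (map₂ (λ step → q , step , mate) (mates-adjacent g mate λ { refl → e≢c refl }))
      where
      mate : Mate p q
      mate = gq , trans (dom-unique gq me) (sym (dom-unique g (∈dominoAt g)))

lemma1 : (R : Region) (s : Cell) → SquareIn s R →
         {m : ℕ} (D : Fin m → Domino) → IsCovering R D → IsTatami R D →
         Σ (Fin m) (λ i → Crosses s (D i)) →
         Σ Cell (λ c → IsCorner s c × Σ (Fin m) (λ i → (c ∈D D i) × Crosses s (D i)))
lemma1 R s square {m} D covering tatami (k , crosses) = corner-crossing
  where
  open Covering R s square D covering tatami

  corner-crossing : Σ Cell (λ c → IsCorner s c × Σ (Fin m) (λ i → (c ∈D D i) × Crosses s (D i)))
  corner-crossing with all? hasMate? corners
  ... | yes corners-mated =
    contradiction crosses (no-crossing (mated-everywhere tiling (All.lookup corners-mated)))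
  ... | no ¬corners-mated with find (¬All⇒Any¬ hasMate? corners ¬corners-mated)
  ... | p , p∈corners , unmated =
    cellAt s p , ∈corners⇒IsCorner s p∈corners , dominoAt g , ∈dominoAt g , unmated-crosses g unmated
    where g = ∈corners⇒InGrid p∈corners
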